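{- Let $G=(V,E)$ be a simple graph with $n$ vertices, $m$ edges, average degree $d = 2m/n$, and arboricity $\alpha(G)$. Consider the random variable $Y$ produced as follows: pick a uniformly random vertex $u \in V$, then pick a uniformly random neighbor $v$ of $u$; set $Y = 2d_u$ if $u \prec v$ and $Y = 0$ otherwise. Then $\mathbf{E}[Y] = d$ and $\mathbf{Var}[Y] \le 8d\,\alpha(G)$.
   Context: $d_u$ denotes the degree of vertex $u$. The arboricity $\alpha(G)$ is the minimum number of forests needed to cover the edge set of $G$. Degree ordering: $u \prec v$ if $d_u < d_v$, or if $d_u = d_v$ and $id(u) < id(v)$, where vertex IDs are distinct. -}

module Defs where

open import Data.Bool using (Bool; true; false; if_then_else_; _∧_; _∨_)
open import Data.Nat as ℕ using (ℕ; zero; suc; _<ᵇ_; _≡ᵇ_; _≤_)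
open import Data.Fin using (Fin; toℕ)
open import Data.List using (List; []; _∷_; _++_; [_]; length; allFin; filterᵇ; foldr; map)
open import Data.Nat.ListAction using (sum)
open import Data.Product using (_×_)
open import Data.List.Relation.Unary.Unique.Propositional using (Unique)
open import Data.List.Relation.Unary.Linked using (Linked)
open import Data.Integer using (+_)
open import Data.Rational using (ℚ; 0ℚ; _/_; _+_; _*_; _-_)
open import Relation.Binary.PropositionalEquality using (_≡_)
open import Relation.Nullary using (¬_)

-- Finite simple graphs on vertex set Fin n (vertex id(u) = toℕ u),
-- given by a symmetric, irreflexive Boolean adjacency relation.

record Graph (n : ℕ) : Set where
  field
    adj   : Fin n → Fin n → Bool
    sym   : ∀ u v → adj u v ≡ adj v u
    irref : ∀ u → adj u u ≡ false
open Graph public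

nbrs : ∀ {n} → Graph n → Fin n → List (Fin n)
nbrs {n} G u = filterᵇ (adj G u) (allFin n)

deg : ∀ {n} → Graph n → Fin n → ℕ
deg G u = length (nbrs G u)

numEdges : ∀ {n} → Graph n → ℕ
numEdges {n} G =
  sum (map (λ u → length (filterᵇ (λ v → toℕ u <ᵇ toℕ v) (nbrs G u))) (allFin n))

prec : ∀ {n} → Graph n → Fin n → Fin n → Bool
prec G u v = (deg G u <ᵇ deg G v) ∨ ((deg G u ≡ᵇ deg G v) ∧ (toℕ u <ᵇ toℕ v))

-- Rationals: a / b as an element of ℚ (b = 0 never used; mapped to 0)

frac : ℕ → ℕ → ℚ
frac a zero    = 0ℚ
frac a (suc b) = (+ a) / suc b

ℕtoℚ : ℕ → ℚ
ℕtoℚ a = frac a 1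

sumℚ : List ℚ → ℚ
sumℚ = foldr _+_ 0ℚ

avgDeg : ∀ {n} → Graph n → ℚ
avgDeg {n} G = frac (2 ℕ.* numEdges G) n

-- The random experiment: u uniform in V, then v uniform in N(u).
-- Y(u,v) = 2 d_u if u ≺ v, and 0 otherwise.
-- (If u is isolated no neighbour can be picked; then Y = 0.)

Yval : ∀ {n} → Graph n → Fin n → Fin n → ℚ
Yval G u v = if prec G u v then ℕtoℚ (2 ℕ.* deg G u) else 0ℚ

expect : ∀ {n} → Graph n → (ℚ → ℚ) → ℚ
expect {n} G g = sumℚ (map term (allFin n))
  where
  term : Fin n → ℚ
  term u with deg G u
  ... | zero  = frac 1 n * g 0ℚ
  ... | suc k = frac 1 n * (frac 1 (suc k) * sumℚ (map (λ v → g (Yval G u v)) (nbrs G u)))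

EY : ∀ {n} → Graph n → ℚ
EY G = expect G (λ y → y)

VarY : ∀ {n} → Graph n → ℚ
VarY G = expect G (λ y → (y - EY G) * (y - EY G))

record Cycle {n : ℕ} (R : Fin n → Fin n → Bool) : Set where
  field
    x      : Fin n
    xs     : List (Fin n)
    long   : 2 ≤ length xs
    unique : Unique (x ∷ xs)
    closed : Linked (λ a b → R a b ≡ true) (x ∷ xs ++ [ x ])

Acyclic : ∀ {n} → (Fin n → Fin n → Bool) → Set
Acyclic R = ¬ Cycle R

record ForestCover {n : ℕ} (G : Graph n) (k : ℕ) : Set where
  field
    col     : Fin n → Fin n → Fin k
    col-sym : ∀ u v → col u v ≡ col v u
    forest  : ∀ (i : Fin k) →
              Acyclic (λ u v → adj G u v ∧ (toℕ (col u v) ℕ.≡ᵇ toℕ i))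

IsArboricity : ∀ {n} → Graph n → ℕ → Set
IsArboricity G a = ForestCover G a × (∀ k → ForestCover G k → a ≤ k)

-- Given u, Y equals 2 d_u on the d⁺_u neighbours v with u ≺ v and 0 on the others, so
-- E[Y | u] = 2 d⁺_u and E[Y² | u] = 4 d_u d⁺_u.  As ≺ is a strict total order, orienting
-- each edge along ≺ counts it once, hence ∑ d⁺_u = m and E[Y] = 2m/n = d.
--
-- For the variance, Var[Y] ≤ E[Y²] = (4/n) ∑ d_u d⁺_u.  Write d_u = #{t < n : t < d_u}.
-- Since u ≺ v forces d_u ≤ d_v, whenever u lies in S_t = {v : d_v > t} so do all its
-- out-neighbours, and ∑ d_u d⁺_u is at most ∑_t (twice the number of edges inside S_t).
-- Each of the α forests covering G has fewer edges inside S_t than S_t has vertices: a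
-- nonempty forest has a vertex of degree at most 1, for otherwise a walk that never
-- backtracks closes a cycle.  So ∑ d_u d⁺_u ≤ 2α ∑_t |S_t| = 2α ∑ d_u = 4αm, and
-- Var[Y] ≤ 16αm/n = 8dα.

module Submission where

open import Defs renaming (sym to adj-sym; irref to adj-irrefl)

module Counting where
  open import Data.Bool using (Bool; true; false; _∧_; _∨_; not)
  open import Data.Fin using (Fin; zero; suc; toℕ; _≟_)
  open import Data.Fin.Properties as Finₚ using (any?; toℕ-injective; pigeonhole)
  open import Data.List using (List; []; _∷_; _++_; [_]; length; filterᵇ; map; allFin; tabulate; lookup)
  open import Data.List.Membership.Propositional using (_∈_)
  open import Data.List.Membership.Propositional.Properties using (∈-∃++; ∈-lookup)
  open import Data.List.Membership.DecPropositional using (_∈?_)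
  import Data.List.Properties as List
  open import Data.List.Relation.Unary.All as All using (All; []; _∷_)
  open import Data.List.Relation.Unary.All.Properties using (¬Any⇒All¬; ++⁻ˡ; ++⁻ʳ)
  open import Data.List.Relation.Unary.Any using (here; there)
  open import Data.List.Relation.Unary.Linked using (Linked; []; [-]; _∷_)
  open import Data.List.Relation.Unary.Unique.Propositional using (Unique; []; _∷_)
  open import Data.Nat using (ℕ; zero; suc; _+_; _*_; _≤_; _<_; z≤n; s≤s; s≤s⁻¹; _<ᵇ_; _≡ᵇ_; _≤?_)
  open import Data.Nat.ListAction using (sum)
  open import Data.Nat.Properties hiding (_≟_)
  open import Data.Product using (∃; _×_; _,_)
  open import Data.Sum using (_⊎_; inj₁; inj₂)
  open import Function using (_∘_)
  open import Relation.Binary.PropositionalEquality hiding ([_])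
  open import Relation.Nullary using (yes; no; does; ¬?; contradiction)
  open import Relation.Nullary.Decidable using (_×-dec_)
  import Data.Bool.Properties as Bool

  open import Algebra.Properties.Semiring.Sum +-*-semiring
    using (sum-syntax; ∑-comm; ∑-distrib-+; *-distribˡ-sum; *-distribʳ-sum; sum-cong-≗)

  𝟙 : Bool → ℕ
  𝟙 true  = 1
  𝟙 false = 0

  𝟙-∧ : ∀ a b → 𝟙 (a ∧ b) ≡ 𝟙 a * 𝟙 b
  𝟙-∧ true  b = sym (+-identityʳ (𝟙 b))
  𝟙-∧ false b = refl

  𝟙≤1 : ∀ a → 𝟙 a ≤ 1
  𝟙≤1 true  = ≤-refl
  𝟙≤1 false = z≤n

  ∑-mono-≤ : ∀ {n} {f g : Fin n → ℕ} → (∀ i → f i ≤ g i) → ∑[ i < n ] f i ≤ ∑[ i < n ] g i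
  ∑-mono-≤ {zero}  f≤g = ≤-refl
  ∑-mono-≤ {suc n} f≤g = +-mono-≤ (f≤g zero) (∑-mono-≤ (f≤g ∘ suc))

  ∑-const : ∀ n c → ∑[ i < n ] c ≡ n * c
  ∑-const zero    c = refl
  ∑-const (suc n) c = cong (c +_) (∑-const n c)

  ∑-zero : ∀ n → ∑[ i < n ] 0 ≡ 0
  ∑-zero n = trans (∑-const n 0) (*-zeroʳ n)

  ∑-δ : ∀ {n} (j : Fin n) (f : Fin n → ℕ) → ∑[ i < n ] (𝟙 (does (j ≟ i)) * f i) ≡ f j
  ∑-δ {suc n} zero f = trans (cong₂ _+_ (+-identityʳ (f zero)) (∑-zero n)) (+-identityʳ (f zero))
  ∑-δ (suc j) f    = ∑-δ j (f ∘ suc)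

  ∑-toℕ-≡ᵇ : ∀ {n} (j : Fin n) → ∑[ i < n ] 𝟙 (toℕ j ≡ᵇ toℕ i) ≡ 1
  ∑-toℕ-≡ᵇ {suc n} zero = cong suc (∑-zero n)
  ∑-toℕ-≡ᵇ (suc j)      = ∑-toℕ-≡ᵇ j

  ∑²-distrib-+ : ∀ {n} (f g : Fin n → Fin n → ℕ) →
                 ∑[ u < n ] ∑[ v < n ] (f u v + g u v) ≡ ∑[ u < n ] ∑[ v < n ] f u v + ∑[ u < n ] ∑[ v < n ] g u v
  ∑²-distrib-+ {n} f g = trans (sum-cong-≗ λ u → ∑-distrib-+ (f u) (g u))
                               (∑-distrib-+ (λ u → ∑[ v < n ] f u v) (λ u → ∑[ v < n ] g u v))

  sum-tabulate : ∀ {n} (f : Fin n → ℕ) → sum (tabulate f) ≡ ∑[ i < n ] f i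
  sum-tabulate {zero}  f = refl
  sum-tabulate {suc n} f = cong (f zero +_) (sum-tabulate (f ∘ suc))

  sum-map-allFin : ∀ {n} (f : Fin n → ℕ) → sum (map f (allFin n)) ≡ ∑[ i < n ] f i
  sum-map-allFin f = trans (cong sum (List.map-tabulate (λ i → i) f)) (sum-tabulate f)

  module _ {a} {A : Set a} where

    length-filterᵇ : ∀ (p : A → Bool) xs → length (filterᵇ p xs) ≡ sum (map (𝟙 ∘ p) xs)
    length-filterᵇ p []       = refl
    length-filterᵇ p (x ∷ xs) with p x
    ... | true  = cong suc (length-filterᵇ p xs)
    ... | false = length-filterᵇ p xs

    sum-map-filterᵇ : ∀ (p : A → Bool) f xs →
                      sum (map f (filterᵇ p xs)) ≡ sum (map (λ x → 𝟙 (p x) * f x) xs)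
    sum-map-filterᵇ p f []       = refl
    sum-map-filterᵇ p f (x ∷ xs) with p x
    ... | true  = cong₂ _+_ (sym (+-identityʳ (f x))) (sum-map-filterᵇ p f xs)
    ... | false = sum-map-filterᵇ p f xs

    Unique-lookup-injective : ∀ {xs : List A} → Unique xs →
                              ∀ {i j} → lookup xs i ≡ lookup xs j → i ≡ j
    Unique-lookup-injective (_  ∷ _) {zero}  {zero}  _  = refl
    Unique-lookup-injective (x∉ ∷ _) {zero}  {suc j} eq = contradiction eq (All.lookup x∉ (∈-lookup j))
    Unique-lookup-injective (x∉ ∷ _) {suc i} {zero}  eq = contradiction (sym eq) (All.lookup x∉ (∈-lookup i))
    Unique-lookup-injective (_  ∷ u) {suc i} {suc j} eq = cong suc (Unique-lookup-injective u eq)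

    Unique-∷-prefix : ∀ (xs : List A) {w : A} {ys : List A} → Unique (xs ++ w ∷ ys) → Unique (w ∷ xs)
    Unique-∷-prefix []       _        = [] ∷ []
    Unique-∷-prefix (x ∷ xs) (x∉ ∷ u) with Unique-∷-prefix xs u
    ... | w∉xs ∷ uxs = (≢-sym (All.head (++⁻ʳ xs x∉)) ∷ w∉xs) ∷ (++⁻ˡ xs x∉ ∷ uxs)

    Linked-prefix : ∀ {ℓ} {R : A → A → Set ℓ} xs {w ys} → Linked R (xs ++ w ∷ ys) → Linked R (xs ++ [ w ])
    Linked-prefix []            _       = [-]
    Linked-prefix (x ∷ [])      (r ∷ _) = r ∷ [-]
    Linked-prefix (x ∷ y ∷ xs)  (r ∷ l) = r ∷ Linked-prefix (y ∷ xs) l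

  Unique⇒length≤ : ∀ {n} {xs : List (Fin n)} → Unique xs → length xs ≤ n
  Unique⇒length≤ {xs = xs} u = ≮⇒≥ λ n<len →
    let i , j , i<j , eq = pigeonhole n<len (lookup xs)
    in Finₚ.<⇒≢ i<j (Unique-lookup-injective u eq)

  -- Induced subgraphs of forests

  card : ∀ {n} → (Fin n → Bool) → ℕ
  card {n} S = ∑[ u < n ] 𝟙 (S u)

  module _ {n : ℕ} (R : Fin n → Fin n → Bool) where

    degIn : (Fin n → Bool) → Fin n → ℕ
    degIn S u = ∑[ v < n ] (𝟙 (S v) * 𝟙 (R u v))

    degSumIn : (Fin n → Bool) → ℕ
    degSumIn S = ∑[ u < n ] (𝟙 (S u) * degIn S u)

  module _ {n : ℕ} {S S′ : Fin n → Bool} {x : Fin n}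
           (split : ∀ v → 𝟙 (S v) ≡ 𝟙 (S′ v) + 𝟙 (does (x ≟ v))) where

    ∑-remove : ∀ f → ∑[ v < n ] (𝟙 (S v) * f v) ≡ ∑[ v < n ] (𝟙 (S′ v) * f v) + f x
    ∑-remove f = begin
      ∑[ v < n ] (𝟙 (S v) * f v)
        ≡⟨ sum-cong-≗ (λ v → trans (cong (_* f v) (split v)) (*-distribʳ-+ (f v) (𝟙 (S′ v)) _)) ⟩
      ∑[ v < n ] (𝟙 (S′ v) * f v + 𝟙 (does (x ≟ v)) * f v)
        ≡⟨ ∑-distrib-+ (λ v → 𝟙 (S′ v) * f v) (λ v → 𝟙 (does (x ≟ v)) * f v) ⟩
      ∑[ v < n ] (𝟙 (S′ v) * f v) + ∑[ v < n ] (𝟙 (does (x ≟ v)) * f v)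
        ≡⟨ cong (_ +_) (∑-δ x f) ⟩
      ∑[ v < n ] (𝟙 (S′ v) * f v) + f x ∎
      where open ≡-Reasoning

    card-remove : card S ≡ suc (card S′)
    card-remove = begin
      card S                               ≡⟨ sum-cong-≗ (λ v → sym (*-identityʳ (𝟙 (S v)))) ⟩
      ∑[ v < n ] (𝟙 (S v) * 1)             ≡⟨ ∑-remove (λ _ → 1) ⟩
      ∑[ v < n ] (𝟙 (S′ v) * 1) + 1        ≡⟨ +-comm _ 1 ⟩
      suc (∑[ v < n ] (𝟙 (S′ v) * 1))      ≡⟨ cong suc (sum-cong-≗ (λ v → *-identityʳ (𝟙 (S′ v)))) ⟩
      suc (card S′)                        ∎
      where open ≡-Reasoning

    degSumIn-remove : ∀ {R} → (∀ u v → R u v ≡ R v u) →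
                      degSumIn R S ≤ degSumIn R S′ + 2 * degIn R S x
    degSumIn-remove {R} R-sym = begin
      degSumIn R S
        ≡⟨ ∑-remove (degIn R S) ⟩
      ∑[ u < n ] (𝟙 (S′ u) * degIn R S u) + degIn R S x
        ≡⟨ cong (_+ degIn R S x) (sum-cong-≗ λ u → cong (𝟙 (S′ u) *_) (∑-remove (λ v → 𝟙 (R u v)))) ⟩
      ∑[ u < n ] (𝟙 (S′ u) * (degIn R S′ u + 𝟙 (R u x))) + degIn R S x
        ≡⟨ cong (_+ degIn R S x) (trans (sum-cong-≗ λ u → *-distribˡ-+ (𝟙 (S′ u)) (degIn R S′ u) _)
                                            (∑-distrib-+ (λ u → 𝟙 (S′ u) * degIn R S′ u) (λ u → 𝟙 (S′ u) * 𝟙 (R u x)))) ⟩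
      degSumIn R S′ + ∑[ u < n ] (𝟙 (S′ u) * 𝟙 (R u x)) + degIn R S x
        ≤⟨ +-monoˡ-≤ (degIn R S x) (+-monoʳ-≤ (degSumIn R S′) back-edges) ⟩
      degSumIn R S′ + degIn R S x + degIn R S x
        ≡⟨ +-assoc (degSumIn R S′) _ _ ⟩
      degSumIn R S′ + (degIn R S x + degIn R S x)
        ≡⟨ cong (degSumIn R S′ +_) (cong (degIn R S x +_) (sym (+-identityʳ _))) ⟩
      degSumIn R S′ + 2 * degIn R S x ∎
      where
      open ≤-Reasoning
      back-edges : ∑[ u < n ] (𝟙 (S′ u) * 𝟙 (R u x)) ≤ degIn R S x
      back-edges = ∑-mono-≤ λ u →
        *-mono-≤ (subst (𝟙 (S′ u) ≤_) (sym (split u)) (m≤m+n _ _)) (≤-reflexive (cong 𝟙 (R-sym u x)))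

  remove-split : ∀ {n} {S : Fin n → Bool} {x} → S x ≡ true →
                 ∀ v → 𝟙 (S v) ≡ 𝟙 (S v ∧ not (does (x ≟ v))) + 𝟙 (does (x ≟ v))
  remove-split {S = S} {x} Sx v with x ≟ v
  ... | yes refl rewrite Sx = refl
  ... | no _     = trans (cong 𝟙 (sym (Bool.∧-identityʳ (S v)))) (sym (+-identityʳ _))

  module Forest {n : ℕ} {R : Fin n → Fin n → Bool}
                (R-sym : ∀ u v → R u v ≡ R v u) (R-irrefl : ∀ u → R u u ≡ false) where

    private
      _~_ : Fin n → Fin n → Set
      u ~ v = R u v ≡ true

      ~-sym : ∀ {u v} → u ~ v → v ~ u
      ~-sym {u} {v} = trans (R-sym v u)

    cycle-closing : ∀ {y p w ys} → Unique (y ∷ p ∷ ys) → Linked _~_ (y ∷ p ∷ ys) →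
                    y ~ w → w ∈ ys → Cycle R
    cycle-closing {y} {p} {w} u l y~w w∈ys with ∈-∃++ w∈ys
    ... | pre , _ , refl = record
      { x      = w
      ; xs     = y ∷ p ∷ pre
      ; long   = s≤s (s≤s z≤n)
      ; unique = Unique-∷-prefix (y ∷ p ∷ pre) u
      ; closed = ~-sym y~w ∷ Linked-prefix (y ∷ p ∷ pre) l
      }

    module _ {S : Fin n → Bool} (minDeg : ∀ x → S x ≡ true → 2 ≤ degIn R S x) where

      neighbour-avoiding : ∀ {y} → S y ≡ true → ∀ p → ∃ λ w → y ~ w × S w ≡ true × w ≢ p
      neighbour-avoiding {y} Sy p
        with any? (λ w → (R y w Bool.≟ true) ×-dec (S w Bool.≟ true) ×-dec ¬? (w ≟ p))
      ... | yes found = found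
      ... | no ∄w     = contradiction (≤-trans (minDeg y Sy) deg≤1) λ { (s≤s ()) }
        where
        only-p : ∀ v → 𝟙 (S v) * 𝟙 (R y v) ≤ 𝟙 (does (p ≟ v)) * 1
        only-p v with p ≟ v
        ... | yes refl = *-mono-≤ (𝟙≤1 (S v)) (𝟙≤1 (R y v))
        ... | no p≢v with R y v in y~v | S v in Sv
        ...   | true  | true  = contradiction (v , y~v , Sv , p≢v ∘ sym) ∄w
        ...   | true  | false = z≤n
        ...   | false | true  = z≤n
        ...   | false | false = z≤n
        deg≤1 : degIn R S y ≤ 1
        deg≤1 = ≤-trans (∑-mono-≤ only-p) (≤-reflexive (∑-δ p (λ _ → 1)))

      -- Extend the path by an S-neighbour of its head other than the previous vertex; meeting
      -- the path again closes a cycle.  A duplicate-free path has at most n vertices.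
      walk : ∀ fuel y p ys → n < length (y ∷ p ∷ ys) + fuel → S y ≡ true →
             Unique (y ∷ p ∷ ys) → Linked _~_ (y ∷ p ∷ ys) → Cycle R
      walk zero y p ys n< _ u _ =
        contradiction (Unique⇒length≤ u) (<⇒≱ (subst (n <_) (+-identityʳ _) n<))
      walk (suc fuel) y p ys n< Sy u l with neighbour-avoiding Sy p
      ... | w , y~w , Sw , w≢p with _∈?_ _≟_ w (y ∷ p ∷ ys)
      ...   | yes (here refl)          = contradiction (trans (sym y~w) (R-irrefl y)) λ ()
      ...   | yes (there (here w≡p))   = contradiction w≡p w≢p
      ...   | yes (there (there w∈ys)) = cycle-closing u l y~w w∈ys
      ...   | no w∉ = walk fuel w y (p ∷ ys) (subst (n <_) (+-suc _ fuel) n<) Sw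
                        (¬Any⇒All¬ _ w∉ ∷ u) (~-sym y~w ∷ l)

      minDeg≥2⇒cycle : ∀ {x} → S x ≡ true → Cycle R
      minDeg≥2⇒cycle {x} Sx with neighbour-avoiding Sx x
      ... | w , x~w , Sw , w≢x =
        walk n w x [] (s≤s (n≤1+n n)) Sw ((w≢x ∷ []) ∷ [] ∷ []) (~-sym x~w ∷ [-])

    leaf-or-empty : Acyclic R → ∀ S →
                    (∃ λ x → S x ≡ true × degIn R S x ≤ 1) ⊎ (∀ x → S x ≡ false)
    leaf-or-empty acyclic S with any? (λ x → (S x Bool.≟ true) ×-dec (degIn R S x ≤? 1))
    ... | yes leaf = inj₁ leaf
    ... | no ∄leaf with any? (λ x → S x Bool.≟ true)
    ...   | yes (x , Sx) = contradiction (minDeg≥2⇒cycle minDeg Sx) acyclic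
      where
      minDeg : ∀ x → S x ≡ true → 2 ≤ degIn R S x
      minDeg x Sx = ≰⇒> λ deg≤1 → ∄leaf (x , Sx , deg≤1)
    ...   | no ∄x = inj₂ λ x → Bool.¬-not (∄x ∘ (x ,_))

    degSumIn≤2*card : Acyclic R → ∀ S → degSumIn R S ≤ 2 * card S
    degSumIn≤2*card acyclic S = go (card S) S ≤-refl
      where
      go : ∀ k S → card S ≤ k → degSumIn R S ≤ 2 * card S
      go k S size with leaf-or-empty acyclic S
      ... | inj₂ empty = subst (_≤ 2 * card S) (sym no-edges) z≤n
        where
        no-edges : degSumIn R S ≡ 0
        no-edges = trans (sum-cong-≗ λ u → cong (λ b → 𝟙 b * degIn R S u) (empty u)) (∑-zero n)
      ... | inj₁ (x , Sx , deg≤1) = step k size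
        where
        S′ : Fin n → Bool
        S′ v = S v ∧ not (does (x ≟ v))
        split : ∀ v → 𝟙 (S v) ≡ 𝟙 (S′ v) + 𝟙 (does (x ≟ v))
        split = remove-split Sx
        card-S : card S ≡ suc (card S′)
        card-S = card-remove {S = S} {S′} {x} split
        step : ∀ k → card S ≤ k → degSumIn R S ≤ 2 * card S
        step zero    size = contradiction (subst (_≤ 0) card-S size) λ ()
        step (suc k) size = begin
          degSumIn R S                      ≤⟨ degSumIn-remove {S = S} {S′} {x} split R-sym ⟩
          degSumIn R S′ + 2 * degIn R S x   ≤⟨ +-mono-≤ (go k S′ (s≤s⁻¹ (subst (_≤ suc k) card-S size)))
                                                        (*-monoʳ-≤ 2 deg≤1) ⟩
          2 * card S′ + 2                   ≡⟨ +-comm (2 * card S′) 2 ⟩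
          2 + 2 * card S′                   ≡⟨ sym (*-suc 2 (card S′)) ⟩
          2 * suc (card S′)                 ≡⟨ cong (2 *_) (sym card-S) ⟩
          2 * card S                        ∎
          where open ≤-Reasoning

  -- The degree ordering and the layers of the degree sequence

  𝟙-mono : ∀ {a b} → (a ≡ true → b ≡ true) → 𝟙 a ≤ 𝟙 b
  𝟙-mono {false} _   = z≤n
  𝟙-mono {true}  a⇒b rewrite a⇒b refl = ≤-refl

  𝟙*-monoʳ-≤ : ∀ b {x y} → (b ≡ true → x ≤ y) → 𝟙 b * x ≤ 𝟙 b * y
  𝟙*-monoʳ-≤ false _   = z≤n
  𝟙*-monoʳ-≤ true  x≤y = +-monoˡ-≤ 0 (x≤y refl)

  𝟙-<ᵇ-total : ∀ a b → a ≢ b → 𝟙 (a <ᵇ b) + 𝟙 (b <ᵇ a) ≡ 1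
  𝟙-<ᵇ-total zero    zero    a≢b = contradiction refl a≢b
  𝟙-<ᵇ-total zero    (suc b) _   = refl
  𝟙-<ᵇ-total (suc a) zero    _   = refl
  𝟙-<ᵇ-total (suc a) (suc b) a≢b = 𝟙-<ᵇ-total a b (a≢b ∘ cong suc)

  𝟙-lex-total : ∀ a b {i j} → i ≢ j →
                𝟙 ((a <ᵇ b) ∨ ((a ≡ᵇ b) ∧ (i <ᵇ j))) + 𝟙 ((b <ᵇ a) ∨ ((b ≡ᵇ a) ∧ (j <ᵇ i))) ≡ 1
  𝟙-lex-total zero    zero    i≢j = 𝟙-<ᵇ-total _ _ i≢j
  𝟙-lex-total zero    (suc b) _   = refl
  𝟙-lex-total (suc a) zero    _   = refl
  𝟙-lex-total (suc a) (suc b) i≢j = 𝟙-lex-total a b i≢j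

  lex⇒≤ : ∀ a b p → ((a <ᵇ b) ∨ ((a ≡ᵇ b) ∧ p)) ≡ true → a ≤ b
  lex⇒≤ zero    b       p _  = z≤n
  lex⇒≤ (suc a) zero    p ()
  lex⇒≤ (suc a) (suc b) p lt = s≤s (lex⇒≤ a b p lt)

  <ᵇ-mono : ∀ t {a b} → a ≤ b → (t <ᵇ a) ≡ true → (t <ᵇ b) ≡ true
  <ᵇ-mono zero    {zero}  _         ()
  <ᵇ-mono zero    {suc a} (s≤s _)   _  = refl
  <ᵇ-mono (suc t) {zero}  _         ()
  <ᵇ-mono (suc t) {suc a} (s≤s a≤b) lt = <ᵇ-mono t a≤b lt

  ∑-layers : ∀ {N} d → d ≤ N → ∑[ t < N ] 𝟙 (toℕ t <ᵇ d) ≡ d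
  ∑-layers {N}     zero    _         = ∑-zero N
  ∑-layers {suc N} (suc d) (s≤s d≤N) = cong suc (∑-layers d d≤N)

  module _ {n k : ℕ} (R : Fin n → Fin n → Bool) (Rᵢ : Fin k → Fin n → Fin n → Bool)
           (R-split : ∀ u v → 𝟙 (R u v) ≡ ∑[ i < k ] 𝟙 (Rᵢ i u v)) where

    degIn-∑ : ∀ S u → degIn R S u ≡ ∑[ i < k ] degIn (Rᵢ i) S u
    degIn-∑ S u = begin
      ∑[ v < n ] (𝟙 (S v) * 𝟙 (R u v))                 ≡⟨ sum-cong-≗ (λ v → cong (𝟙 (S v) *_) (R-split u v)) ⟩
      ∑[ v < n ] (𝟙 (S v) * ∑[ i < k ] 𝟙 (Rᵢ i u v))   ≡⟨ sum-cong-≗ (λ v → *-distribˡ-sum (𝟙 (S v)) (λ i → 𝟙 (Rᵢ i u v))) ⟩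
      ∑[ v < n ] ∑[ i < k ] (𝟙 (S v) * 𝟙 (Rᵢ i u v))   ≡⟨ ∑-comm (λ v i → 𝟙 (S v) * 𝟙 (Rᵢ i u v)) ⟩
      ∑[ i < k ] degIn (Rᵢ i) S u                      ∎
      where open ≡-Reasoning

    degSumIn-∑ : ∀ S → degSumIn R S ≡ ∑[ i < k ] degSumIn (Rᵢ i) S
    degSumIn-∑ S = begin
      ∑[ u < n ] (𝟙 (S u) * degIn R S u)
        ≡⟨ sum-cong-≗ (λ u → cong (𝟙 (S u) *_) (degIn-∑ S u)) ⟩
      ∑[ u < n ] (𝟙 (S u) * ∑[ i < k ] degIn (Rᵢ i) S u)
        ≡⟨ sum-cong-≗ (λ u → *-distribˡ-sum (𝟙 (S u)) (λ i → degIn (Rᵢ i) S u)) ⟩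
      ∑[ u < n ] ∑[ i < k ] (𝟙 (S u) * degIn (Rᵢ i) S u)
        ≡⟨ ∑-comm (λ u i → 𝟙 (S u) * degIn (Rᵢ i) S u) ⟩
      ∑[ i < k ] degSumIn (Rᵢ i) S ∎
      where open ≡-Reasoning

  module _ {n : ℕ} (G : Graph n) where

    outDeg : Fin n → ℕ
    outDeg u = length (filterᵇ (prec G u) (nbrs G u))

    outDeg≤deg : ∀ u → outDeg u ≤ deg G u
    outDeg≤deg u = List.length-filter (Bool.T? ∘ prec G u) (nbrs G u)

    degAbove : ℕ → Fin n → Bool
    degAbove t u = t <ᵇ deg G u

    length-filterᵇ-nbrs : ∀ (p : Fin n → Bool) u →
                          length (filterᵇ p (nbrs G u)) ≡ ∑[ v < n ] (𝟙 (adj G u v) * 𝟙 (p v))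
    length-filterᵇ-nbrs p u = begin
      length (filterᵇ p (nbrs G u))                          ≡⟨ length-filterᵇ p (nbrs G u) ⟩
      sum (map (𝟙 ∘ p) (nbrs G u))                           ≡⟨ sum-map-filterᵇ (adj G u) (𝟙 ∘ p) (allFin n) ⟩
      sum (map (λ v → 𝟙 (adj G u v) * 𝟙 (p v)) (allFin n))   ≡⟨ sum-map-allFin (λ v → 𝟙 (adj G u v) * 𝟙 (p v)) ⟩
      ∑[ v < n ] (𝟙 (adj G u v) * 𝟙 (p v))                   ∎
      where open ≡-Reasoning

    deg-∑ : ∀ u → deg G u ≡ ∑[ v < n ] 𝟙 (adj G u v)
    deg-∑ u = trans (length-filterᵇ (adj G u) (allFin n)) (sum-map-allFin (𝟙 ∘ adj G u))

    deg≤n : ∀ u → deg G u ≤ n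
    deg≤n u = begin
      deg G u                    ≡⟨ deg-∑ u ⟩
      ∑[ v < n ] 𝟙 (adj G u v)   ≤⟨ ∑-mono-≤ (𝟙≤1 ∘ adj G u) ⟩
      ∑[ v < n ] 1               ≡⟨ ∑-const n 1 ⟩
      n * 1                      ≡⟨ *-identityʳ n ⟩
      n                          ∎
      where open ≤-Reasoning

    orientedEdges : (Fin n → Fin n → Bool) → ℕ
    orientedEdges O = ∑[ u < n ] ∑[ v < n ] (𝟙 (adj G u v) * 𝟙 (O u v))

    2*orientedEdges≡∑-deg : ∀ O → (∀ {u v} → u ≢ v → 𝟙 (O u v) + 𝟙 (O v u) ≡ 1) →
                            2 * orientedEdges O ≡ ∑[ u < n ] deg G u
    2*orientedEdges≡∑-deg O O-total = begin
      2 * orientedEdges O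
        ≡⟨ cong (orientedEdges O +_) (+-identityʳ _) ⟩
      orientedEdges O + orientedEdges O
        ≡⟨ cong (orientedEdges O +_) (∑-comm (λ u v → 𝟙 (adj G u v) * 𝟙 (O u v))) ⟩
      orientedEdges O + ∑[ u < n ] ∑[ v < n ] (𝟙 (adj G v u) * 𝟙 (O v u))
        ≡⟨ sym (∑²-distrib-+ (λ u v → 𝟙 (adj G u v) * 𝟙 (O u v)) (λ u v → 𝟙 (adj G v u) * 𝟙 (O v u))) ⟩
      ∑[ u < n ] ∑[ v < n ] (𝟙 (adj G u v) * 𝟙 (O u v) + 𝟙 (adj G v u) * 𝟙 (O v u))
        ≡⟨ sum-cong-≗ (λ u → sum-cong-≗ (counted-once u)) ⟩
      ∑[ u < n ] ∑[ v < n ] 𝟙 (adj G u v)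
        ≡⟨ sum-cong-≗ (sym ∘ deg-∑) ⟩
      ∑[ u < n ] deg G u ∎
      where
      open ≡-Reasoning
      counted-once : ∀ u v → 𝟙 (adj G u v) * 𝟙 (O u v) + 𝟙 (adj G v u) * 𝟙 (O v u) ≡ 𝟙 (adj G u v)
      counted-once u v rewrite adj-sym G v u with u ≟ v
      ... | yes refl rewrite adj-irrefl G u = refl
      ... | no u≢v = trans (sym (*-distribˡ-+ (𝟙 (adj G u v)) _ _))
                           (trans (cong (𝟙 (adj G u v) *_) (O-total u≢v)) (*-identityʳ _))

    ∑-deg : ∑[ u < n ] deg G u ≡ 2 * numEdges G
    ∑-deg = sym (begin
      2 * numEdges G
        ≡⟨ cong (2 *_) (trans (sum-map-allFin (λ u → length (filterᵇ (λ v → toℕ u <ᵇ toℕ v) (nbrs G u))))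
                              (sum-cong-≗ λ u → length-filterᵇ-nbrs (λ v → toℕ u <ᵇ toℕ v) u)) ⟩
      2 * orientedEdges (λ u v → toℕ u <ᵇ toℕ v)
        ≡⟨ 2*orientedEdges≡∑-deg _ (λ u≢v → 𝟙-<ᵇ-total _ _ (u≢v ∘ toℕ-injective)) ⟩
      ∑[ u < n ] deg G u ∎)
      where open ≡-Reasoning

    𝟙-prec-total : ∀ {u v} → u ≢ v → 𝟙 (prec G u v) + 𝟙 (prec G v u) ≡ 1
    𝟙-prec-total {u} {v} u≢v = 𝟙-lex-total (deg G u) (deg G v) (u≢v ∘ toℕ-injective)

    ∑-outDeg : ∑[ u < n ] outDeg u ≡ numEdges G
    ∑-outDeg = *-cancelˡ-≡ _ _ 2 (begin
      2 * ∑[ u < n ] outDeg u     ≡⟨ cong (2 *_) (sum-cong-≗ λ u → length-filterᵇ-nbrs (prec G u) u) ⟩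
      2 * orientedEdges (prec G)  ≡⟨ 2*orientedEdges≡∑-deg (prec G) 𝟙-prec-total ⟩
      ∑[ u < n ] deg G u          ≡⟨ ∑-deg ⟩
      2 * numEdges G              ∎)
      where open ≡-Reasoning

    outDeg≤degIn-degAbove : ∀ t u → degAbove t u ≡ true → outDeg u ≤ degIn (adj G) (degAbove t) u
    outDeg≤degIn-degAbove t u t<du = begin
      outDeg u                                           ≡⟨ length-filterᵇ-nbrs (prec G u) u ⟩
      ∑[ v < n ] (𝟙 (adj G u v) * 𝟙 (prec G u v))        ≤⟨ ∑-mono-≤ (λ v → *-monoʳ-≤ (𝟙 (adj G u v)) (𝟙-mono (t<dv v))) ⟩
      ∑[ v < n ] (𝟙 (adj G u v) * 𝟙 (degAbove t v))      ≡⟨ sum-cong-≗ (λ v → *-comm (𝟙 (adj G u v)) _) ⟩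
      degIn (adj G) (degAbove t) u                       ∎
      where
      open ≤-Reasoning
      t<dv : ∀ v → prec G u v ≡ true → degAbove t v ≡ true
      t<dv v u≺v = <ᵇ-mono t (lex⇒≤ (deg G u) (deg G v) _ u≺v) t<du

    ∑-deg*outDeg≤∑-degSumIn : ∑[ u < n ] (deg G u * outDeg u) ≤ ∑[ t < n ] degSumIn (adj G) (degAbove (toℕ t))
    ∑-deg*outDeg≤∑-degSumIn = begin
      ∑[ u < n ] (deg G u * outDeg u)
        ≡⟨ sum-cong-≗ (λ u → trans (cong (_* outDeg u) (sym (∑-layers {n} (deg G u) (deg≤n u))))
                                   (*-distribʳ-sum {n} (outDeg u) (λ t → 𝟙 (degAbove (toℕ t) u)))) ⟩
      ∑[ u < n ] ∑[ t < n ] (𝟙 (degAbove (toℕ t) u) * outDeg u)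
        ≤⟨ ∑-mono-≤ (λ u → ∑-mono-≤ {n} λ t →
             𝟙*-monoʳ-≤ (degAbove (toℕ t) u) (outDeg≤degIn-degAbove (toℕ t) u)) ⟩
      ∑[ u < n ] ∑[ t < n ] (𝟙 (degAbove (toℕ t) u) * degIn (adj G) (degAbove (toℕ t)) u)
        ≡⟨ ∑-comm {n} {n} (λ u t → 𝟙 (degAbove (toℕ t) u) * degIn (adj G) (degAbove (toℕ t)) u) ⟩
      ∑[ t < n ] degSumIn (adj G) (degAbove (toℕ t)) ∎
      where open ≤-Reasoning

    ∑-card-degAbove : ∑[ t < n ] card (degAbove (toℕ t)) ≡ ∑[ u < n ] deg G u
    ∑-card-degAbove = trans (∑-comm {n} {n} (λ t u → 𝟙 (degAbove (toℕ t) u)))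
                            (sum-cong-≗ λ u → ∑-layers {n} (deg G u) (deg≤n u))

    module _ {α : ℕ} (cover : ForestCover G α) where
      open ForestCover cover

      colourClass : Fin α → Fin n → Fin n → Bool
      colourClass i u v = adj G u v ∧ (toℕ (col u v) ≡ᵇ toℕ i)

      𝟙-adj-∑-colourClass : ∀ u v → 𝟙 (adj G u v) ≡ ∑[ i < α ] 𝟙 (colourClass i u v)
      𝟙-adj-∑-colourClass u v = begin
        𝟙 (adj G u v)
          ≡⟨ sym (*-identityʳ _) ⟩
        𝟙 (adj G u v) * 1
          ≡⟨ cong (𝟙 (adj G u v) *_) (sym (∑-toℕ-≡ᵇ {α} (col u v))) ⟩
        𝟙 (adj G u v) * ∑[ i < α ] 𝟙 (toℕ (col u v) ≡ᵇ toℕ i)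
          ≡⟨ *-distribˡ-sum {α} (𝟙 (adj G u v)) (λ i → 𝟙 (toℕ (col u v) ≡ᵇ toℕ i)) ⟩
        ∑[ i < α ] (𝟙 (adj G u v) * 𝟙 (toℕ (col u v) ≡ᵇ toℕ i))
          ≡⟨ sum-cong-≗ {α} (λ i → sym (𝟙-∧ (adj G u v) (toℕ (col u v) ≡ᵇ toℕ i))) ⟩
        ∑[ i < α ] 𝟙 (colourClass i u v) ∎
        where open ≡-Reasoning

      colourClass-sym : ∀ i u v → colourClass i u v ≡ colourClass i v u
      colourClass-sym i u v = cong₂ (λ a c → a ∧ (toℕ c ≡ᵇ toℕ i)) (adj-sym G u v) (col-sym u v)

      colourClass-irrefl : ∀ i u → colourClass i u u ≡ false
      colourClass-irrefl i u = cong (_∧ (toℕ (col u u) ≡ᵇ toℕ i)) (adj-irrefl G u)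

      degSumIn-adj≤ : ∀ S → degSumIn (adj G) S ≤ α * (2 * card S)
      degSumIn-adj≤ S = begin
        degSumIn (adj G) S                      ≡⟨ degSumIn-∑ (adj G) colourClass 𝟙-adj-∑-colourClass S ⟩
        ∑[ i < α ] degSumIn (colourClass i) S   ≤⟨ ∑-mono-≤ (λ i → Forest.degSumIn≤2*card (colourClass-sym i)
                                                                     (colourClass-irrefl i) (forest i) S) ⟩
        ∑[ i < α ] (2 * card S)                 ≡⟨ ∑-const α (2 * card S) ⟩
        α * (2 * card S)                        ∎
        where open ≤-Reasoning

      ∑-deg*outDeg≤ : ∑[ u < n ] (deg G u * outDeg u) ≤ α * (2 * ∑[ u < n ] deg G u)
      ∑-deg*outDeg≤ = begin
        ∑[ u < n ] (deg G u * outDeg u)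
          ≤⟨ ∑-deg*outDeg≤∑-degSumIn ⟩
        ∑[ t < n ] degSumIn (adj G) (degAbove (toℕ t))
          ≤⟨ ∑-mono-≤ {n} (λ t → degSumIn-adj≤ (degAbove (toℕ t))) ⟩
        ∑[ t < n ] (α * (2 * card (degAbove (toℕ t))))
          ≡⟨ sym (*-distribˡ-sum {n} α (λ t → 2 * card (degAbove (toℕ t)))) ⟩
        α * ∑[ t < n ] (2 * card (degAbove (toℕ t)))
          ≡⟨ cong (α *_) (sym (*-distribˡ-sum {n} 2 (λ t → card (degAbove (toℕ t))))) ⟩
        α * (2 * ∑[ t < n ] card (degAbove (toℕ t)))
          ≡⟨ cong (λ s → α * (2 * s)) ∑-card-degAbove ⟩
        α * (2 * ∑[ u < n ] deg G u) ∎
        where open ≤-Reasoning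

module Moments where
  open import Data.Bool using (Bool; true; false; if_then_else_)
  open import Data.Fin using (Fin)
  import Data.Integer as ℤ
  import Data.Integer.Properties as ℤ
  open import Data.Integer.Tactic.RingSolver using (solve-∀)
  open import Data.List using (List; []; _∷_; length; filterᵇ; map; allFin)
  import Data.List.Properties as List
  open import Data.Nat as ℕ using (ℕ; zero; suc)
  import Data.Nat.Properties as ℕ
  open import Data.Nat.ListAction using (sum)
  import Data.Nat.Tactic.RingSolver as ℕ-Solver
  open import Data.Rational using (ℚ; 0ℚ; 1ℚ; _+_; _*_; _-_; -_; _≤_; toℚᵘ)
  open import Data.Rational.Properties
  open import Data.Rational.Solver using (module +-*-Solver)
  open import Data.Rational.Unnormalised as ℚᵘ using (mkℚᵘ; *≡*; _≃_)
  import Data.Rational.Unnormalised.Properties as ℚᵘ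
  open import Function using (_∘_)
  open import Relation.Binary.PropositionalEquality

  open Counting using (outDeg; outDeg≤deg; sum-map-allFin; ∑-const; ∑-outDeg; ∑-deg; ∑-deg*outDeg≤)
  open import Algebra.Properties.Semiring.Sum ℕ.+-*-semiring using (sum-syntax; *-distribˡ-sum; sum-cong-≗)

  mkℚᵘ-≃ : ∀ {a b c d} → a ℕ.* suc d ≡ c ℕ.* suc b → mkℚᵘ (ℤ.+ a) b ≃ mkℚᵘ (ℤ.+ c) d
  mkℚᵘ-≃ {a} {b} {c} {d} eq = *≡* (trans (sym (ℤ.pos-* a (suc d))) (trans (cong ℤ.+_ eq) (ℤ.pos-* c (suc b))))

  frac-≡ : ∀ a b c d → a ℕ.* suc d ≡ c ℕ.* suc b → frac a (suc b) ≡ frac c (suc d)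
  frac-≡ a b c d eq = fromℚᵘ-cong {mkℚᵘ (ℤ.+ a) b} {mkℚᵘ (ℤ.+ c) d} (mkℚᵘ-≃ eq)

  frac-toℚᵘ : ∀ a b → toℚᵘ (frac a (suc b)) ≃ mkℚᵘ (ℤ.+ a) b
  frac-toℚᵘ a b = toℚᵘ-fromℚᵘ (mkℚᵘ (ℤ.+ a) b)

  frac-+ : ∀ a c b → frac a (suc b) + frac c (suc b) ≡ frac (a ℕ.+ c) (suc b)
  frac-+ a c b = toℚᵘ-injective (begin
    toℚᵘ (frac a B + frac c B)              ≈⟨ toℚᵘ-homo-+ (frac a B) (frac c B) ⟩
    toℚᵘ (frac a B) ℚᵘ.+ toℚᵘ (frac c B)    ≈⟨ ℚᵘ.+-cong (frac-toℚᵘ a b) (frac-toℚᵘ c b) ⟩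
    mkℚᵘ (ℤ.+ a) b ℚᵘ.+ mkℚᵘ (ℤ.+ c) b      ≈⟨ *≡* numerators ⟩
    mkℚᵘ (ℤ.+ (a ℕ.+ c)) b                  ≈⟨ ℚᵘ.≃-sym (frac-toℚᵘ (a ℕ.+ c) b) ⟩
    toℚᵘ (frac (a ℕ.+ c) B)                 ∎)
    where
    open ℚᵘ.≃-Reasoning
    B : ℕ
    B = suc b
    distrib : ∀ (x y z : ℤ.ℤ) → (x ℤ.* z ℤ.+ y ℤ.* z) ℤ.* z ≡ (x ℤ.+ y) ℤ.* (z ℤ.* z)
    distrib = solve-∀
    numerators : (ℤ.+ a ℤ.* ℤ.+ B ℤ.+ ℤ.+ c ℤ.* ℤ.+ B) ℤ.* ℤ.+ B ≡ ℤ.+ (a ℕ.+ c) ℤ.* ℤ.+ (B ℕ.* B)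
    numerators = trans (distrib (ℤ.+ a) (ℤ.+ c) (ℤ.+ B)) (sym (cong₂ ℤ._*_ (ℤ.pos-+ a c) (ℤ.pos-* B B)))

  frac-* : ∀ a b c d → frac a (suc b) * frac c (suc d) ≡ frac (a ℕ.* c) (suc b ℕ.* suc d)
  frac-* a b c d = toℚᵘ-injective (begin
    toℚᵘ (frac a (suc b) * frac c (suc d))            ≈⟨ toℚᵘ-homo-* (frac a (suc b)) (frac c (suc d)) ⟩
    toℚᵘ (frac a (suc b)) ℚᵘ.* toℚᵘ (frac c (suc d))  ≈⟨ ℚᵘ.*-cong (frac-toℚᵘ a b) (frac-toℚᵘ c d) ⟩
    mkℚᵘ (ℤ.+ a) b ℚᵘ.* mkℚᵘ (ℤ.+ c) d                ≈⟨ *≡* (cong (ℤ._* ℤ.+ (suc b ℕ.* suc d)) (sym (ℤ.pos-* a c))) ⟩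
    mkℚᵘ (ℤ.+ (a ℕ.* c)) (d ℕ.+ b ℕ.* suc d)          ≈⟨ ℚᵘ.≃-sym (frac-toℚᵘ (a ℕ.* c) _) ⟩
    toℚᵘ (frac (a ℕ.* c) (suc b ℕ.* suc d))           ∎)
    where open ℚᵘ.≃-Reasoning

  frac-mono-≤ : ∀ {a c} b → a ℕ.≤ c → frac a (suc b) ≤ frac c (suc b)
  frac-mono-≤ {a} {c} b a≤c =
    toℚᵘ-cancel-≤ (ℚᵘ.≤-respˡ-≃ (ℚᵘ.≃-sym (frac-toℚᵘ a b)) (ℚᵘ.≤-respʳ-≃ (ℚᵘ.≃-sym (frac-toℚᵘ c b))
      (ℚᵘ.*≤* (subst₂ ℤ._≤_ (ℤ.pos-* a (suc b)) (ℤ.pos-* c (suc b)) (ℤ.+≤+ (ℕ.*-monoˡ-≤ (suc b) a≤c))))))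

  frac-zero : ∀ b → frac 0 (suc b) ≡ 0ℚ
  frac-zero b = frac-≡ 0 b 0 0 refl

  ℕtoℚ-+ : ∀ a b → ℕtoℚ (a ℕ.+ b) ≡ ℕtoℚ a + ℕtoℚ b
  ℕtoℚ-+ a b = sym (frac-+ a b 0)

  ℕtoℚ-* : ∀ a b → ℕtoℚ (a ℕ.* b) ≡ ℕtoℚ a * ℕtoℚ b
  ℕtoℚ-* a b = sym (frac-* a 0 b 0)

  frac-ℕtoℚ : ∀ a b → frac 1 (suc b) * ℕtoℚ a ≡ frac a (suc b)
  frac-ℕtoℚ a b = trans (frac-* 1 b a 0) (frac-≡ (1 ℕ.* a) (b ℕ.* 1) a b (rearrange a b))
    where
    rearrange : ∀ a b → 1 ℕ.* a ℕ.* suc b ≡ a ℕ.* (suc b ℕ.* 1)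
    rearrange = ℕ-Solver.solve-∀

  frac-cancel : ∀ k a → frac 1 (suc k) * ℕtoℚ (suc k ℕ.* a) ≡ ℕtoℚ a
  frac-cancel k a = trans (frac-ℕtoℚ (suc k ℕ.* a) k) (frac-≡ (suc k ℕ.* a) k a 0 (rearrange k a))
    where
    rearrange : ∀ k a → suc k ℕ.* a ℕ.* 1 ≡ a ℕ.* suc k
    rearrange = ℕ-Solver.solve-∀

  open +-*-Solver

  scale-linear : ∀ a x c y → a * (x + c * y) ≡ a * x + c * (a * y)
  scale-linear = solve 4 (λ a x c y → a :* (x :+ c :* y) := a :* x :+ c :* (a :* y)) refl

  module _ {a} {A : Set a} where

    sumℚ-map-linear : ∀ (xs : List A) {f h k : A → ℚ} c → (∀ x → f x ≡ h x + c * k x) →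
                      sumℚ (map f xs) ≡ sumℚ (map h xs) + c * sumℚ (map k xs)
    sumℚ-map-linear []       c _ = solve 1 (λ c → con 0ℚ := con 0ℚ :+ c :* con 0ℚ) refl c
    sumℚ-map-linear (x ∷ xs) {f} {h} {k} c f≡ = begin
      f x + sumℚ (map f xs)                                     ≡⟨ cong₂ _+_ (f≡ x) (sumℚ-map-linear xs c f≡) ⟩
      (h x + c * k x) + (sumℚ (map h xs) + c * sumℚ (map k xs)) ≡⟨ regroup (h x) (k x) c _ _ ⟩
      (h x + sumℚ (map h xs)) + c * (k x + sumℚ (map k xs))     ∎
      where
      open ≡-Reasoning
      regroup : ∀ a b c d e → (a + c * b) + (d + c * e) ≡ (a + d) + c * (b + e)
      regroup = solve 5 (λ a b c d e → (a :+ c :* b) :+ (d :+ c :* e) := (a :+ d) :+ c :* (b :+ e)) refl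

    sumℚ-map-frac : ∀ (xs : List A) (f : A → ℕ) b →
                    sumℚ (map (λ x → frac (f x) (suc b)) xs) ≡ frac (sum (map f xs)) (suc b)
    sumℚ-map-frac []       f b = sym (frac-zero b)
    sumℚ-map-frac (x ∷ xs) f b = trans (cong (frac (f x) (suc b) +_) (sumℚ-map-frac xs f b)) (frac-+ (f x) _ b)

    sumℚ-map-1 : ∀ (xs : List A) → sumℚ (map (λ _ → 1ℚ) xs) ≡ ℕtoℚ (length xs)
    sumℚ-map-1 []       = refl
    sumℚ-map-1 (x ∷ xs) = trans (cong (1ℚ +_) (sumℚ-map-1 xs)) (sym (ℕtoℚ-+ 1 (length xs)))

    sumℚ-map-if : ∀ {g : ℚ → ℚ} → g 0ℚ ≡ 0ℚ → ∀ (p : A → Bool) c xs →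
                  sumℚ (map (λ x → g (if p x then c else 0ℚ)) xs) ≡ g c * ℕtoℚ (length (filterᵇ p xs))
    sumℚ-map-if {g} g0 p c []       = sym (*-zeroʳ (g c))
    sumℚ-map-if {g} g0 p c (x ∷ xs) with p x
    ... | true  = begin
      g c + sumℚ (map (λ x → g (if p x then c else 0ℚ)) xs)
        ≡⟨ cong (g c +_) (sumℚ-map-if {g} g0 p c xs) ⟩
      g c + g c * ℕtoℚ L
        ≡⟨ solve 2 (λ y l → y :+ y :* l := y :* (con 1ℚ :+ l)) refl (g c) (ℕtoℚ L) ⟩
      g c * (1ℚ + ℕtoℚ L)
        ≡⟨ cong (g c *_) (sym (ℕtoℚ-+ 1 L)) ⟩
      g c * ℕtoℚ (suc L) ∎
      where
      open ≡-Reasoning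
      L : ℕ
      L = length (filterᵇ p xs)
    ... | false = trans (cong₂ _+_ g0 (sumℚ-map-if {g} g0 p c xs)) (+-identityˡ _)

  ℕtoℚ*frac*ℕtoℚ : ∀ a b c n → ℕtoℚ a * frac b (suc n) * ℕtoℚ c ≡ frac (a ℕ.* b ℕ.* c) (suc n)
  ℕtoℚ*frac*ℕtoℚ a b c n = begin
    ℕtoℚ a * frac b (suc n) * ℕtoℚ c              ≡⟨ cong (_* ℕtoℚ c) (frac-* a 0 b n) ⟩
    frac (a ℕ.* b) (1 ℕ.* suc n) * ℕtoℚ c         ≡⟨ frac-* (a ℕ.* b) (n ℕ.+ 0) c 0 ⟩
    frac (a ℕ.* b ℕ.* c) (1 ℕ.* suc n ℕ.* 1)      ≡⟨ frac-≡ abc ((n ℕ.+ 0) ℕ.* 1) abc n (cong (abc ℕ.*_) (unit n)) ⟩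
    frac (a ℕ.* b ℕ.* c) (suc n)                  ∎
    where
    open ≡-Reasoning
    abc : ℕ
    abc = a ℕ.* b ℕ.* c
    unit : ∀ n → suc n ≡ suc ((n ℕ.+ 0) ℕ.* 1)
    unit = ℕ-Solver.solve-∀

  0≤frac : ∀ a b → 0ℚ ≤ frac a (suc b)
  0≤frac a b = subst (_≤ frac a (suc b)) (frac-zero b) (frac-mono-≤ {0} {a} b ℕ.z≤n)

  0≤frac*frac : ∀ a b c d → 0ℚ ≤ frac a (suc b) * frac c (suc d)
  0≤frac*frac a b c d = subst (0ℚ ≤_) (sym (frac-* a b c d)) (0≤frac (a ℕ.* c) (d ℕ.+ b ℕ.* suc d))

  -- Moments of Y

  -- `expect` sums a function that is local to its where-block: `summandOf` recovers it by
  -- unification, and `summandAt G g u d` is its value once `deg G u` is known to be `d`.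
  summandOf : ∀ {n} {f : Fin n → ℚ} {q : ℚ} → q ≡ sumℚ (map f (allFin n)) → Fin n → ℚ
  summandOf {f = f} _ = f

  summandAt : ∀ {n} → Graph n → (ℚ → ℚ) → Fin n → ℕ → ℚ
  summandAt {n} G g u zero    = frac 1 n * g 0ℚ
  summandAt {n} G g u (suc k) = frac 1 n * (frac 1 (suc k) * sumℚ (map (g ∘ Yval G u) (nbrs G u)))

  expect-summands : ∀ {n} (G : Graph n) g →
                    expect G g ≡ sumℚ (map (λ u → summandAt G g u (deg G u)) (allFin n))
  expect-summands {n} G g = cong sumℚ (List.map-cong summand≡summandAt (allFin n))
    where
    summand≡summandAt : ∀ u → summandOf {q = expect G g} refl u ≡ summandAt G g u (deg G u)
    summand≡summandAt u with deg G u
    ... | zero  = refl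
    ... | suc k = refl

  expect-linear : ∀ {n} (G : Graph n) {g p q : ℚ → ℚ} c → (∀ y → g y ≡ p y + c * q y) →
                  expect G g ≡ expect G p + c * expect G q
  expect-linear {n} G {g} {p} {q} c g≡ = begin
    expect G g
      ≡⟨ expect-summands G g ⟩
    sumℚ (map (λ u → summandAt G g u (deg G u)) (allFin n))
      ≡⟨ sumℚ-map-linear (allFin n) c (λ u → summandAt-linear u (deg G u)) ⟩
    sumℚ (map (λ u → summandAt G p u (deg G u)) (allFin n)) + c * sumℚ (map (λ u → summandAt G q u (deg G u)) (allFin n))
      ≡⟨ sym (cong₂ (λ x y → x + c * y) (expect-summands G p) (expect-summands G q)) ⟩
    expect G p + c * expect G q ∎
    where
    open ≡-Reasoning
    summandAt-linear : ∀ u d → summandAt G g u d ≡ summandAt G p u d + c * summandAt G q u d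
    summandAt-linear u zero    = trans (cong (frac 1 n *_) (g≡ 0ℚ)) (scale-linear (frac 1 n) (p 0ℚ) c (q 0ℚ))
    summandAt-linear u (suc k) = begin
      frac 1 n * (frac 1 (suc k) * sumℚ (map (g ∘ Yval G u) (nbrs G u)))
        ≡⟨ cong (λ s → frac 1 n * (frac 1 (suc k) * s)) (sumℚ-map-linear (nbrs G u) c (g≡ ∘ Yval G u)) ⟩
      frac 1 n * (frac 1 (suc k) * (Σp + c * Σq))
        ≡⟨ cong (frac 1 n *_) (scale-linear (frac 1 (suc k)) Σp c Σq) ⟩
      frac 1 n * (frac 1 (suc k) * Σp + c * (frac 1 (suc k) * Σq))
        ≡⟨ scale-linear (frac 1 n) (frac 1 (suc k) * Σp) c (frac 1 (suc k) * Σq) ⟩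
      frac 1 n * (frac 1 (suc k) * Σp) + c * (frac 1 n * (frac 1 (suc k) * Σq)) ∎
      where
      Σp Σq : ℚ
      Σp = sumℚ (map (p ∘ Yval G u) (nbrs G u))
      Σq = sumℚ (map (q ∘ Yval G u) (nbrs G u))

  module _ {n : ℕ} (G : Graph (suc n)) where

    expect-const-1 : expect G (λ _ → 1ℚ) ≡ 1ℚ
    expect-const-1 = begin
      expect G (λ _ → 1ℚ)
        ≡⟨ expect-summands G (λ _ → 1ℚ) ⟩
      sumℚ (map (λ u → summandAt G (λ _ → 1ℚ) u (deg G u)) (allFin (suc n)))
        ≡⟨ cong sumℚ (List.map-cong (λ u → summandAt-1 u (deg G u) refl) (allFin (suc n))) ⟩
      sumℚ (map (λ _ → frac 1 (suc n)) (allFin (suc n)))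
        ≡⟨ sumℚ-map-frac (allFin (suc n)) (λ _ → 1) n ⟩
      frac (sum (map (λ _ → 1) (allFin (suc n)))) (suc n)
        ≡⟨ cong (λ s → frac s (suc n)) count-vertices ⟩
      frac (suc n) (suc n)
        ≡⟨ frac-≡ (suc n) n 1 0 (ℕ.*-comm (suc n) 1) ⟩
      1ℚ ∎
      where
      count-vertices : sum (map (λ _ → 1) (allFin (suc n))) ≡ suc n
      count-vertices = trans (sum-map-allFin {suc n} (λ _ → 1)) (trans (∑-const (suc n) 1) (ℕ.*-identityʳ (suc n)))
      open ≡-Reasoning
      summandAt-1 : ∀ u d → deg G u ≡ d → summandAt G (λ _ → 1ℚ) u d ≡ frac 1 (suc n)
      summandAt-1 u zero    _  = *-identityʳ (frac 1 (suc n))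
      summandAt-1 u (suc k) d≡ = begin
        frac 1 (suc n) * (frac 1 (suc k) * sumℚ (map (λ _ → 1ℚ) (nbrs G u)))
          ≡⟨ cong (λ s → frac 1 (suc n) * (frac 1 (suc k) * s))
                  (trans (sumℚ-map-1 (nbrs G u)) (cong ℕtoℚ (trans d≡ (sym (ℕ.*-identityʳ (suc k)))))) ⟩
        frac 1 (suc n) * (frac 1 (suc k) * ℕtoℚ (suc k ℕ.* 1))
          ≡⟨ cong (frac 1 (suc n) *_) (frac-cancel k 1) ⟩
        frac 1 (suc n) * 1ℚ
          ≡⟨ *-identityʳ (frac 1 (suc n)) ⟩
        frac 1 (suc n) ∎

    module _ {g : ℚ → ℚ} (c : ℕ → ℕ) (g0 : g 0ℚ ≡ 0ℚ) (g2d : ∀ d → g (ℕtoℚ (2 ℕ.* d)) ≡ ℕtoℚ (d ℕ.* c d)) where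

      summandAt-moment : ∀ u d → deg G u ≡ d → summandAt G g u d ≡ frac (c (deg G u) ℕ.* outDeg G u) (suc n)
      summandAt-moment u zero d≡ = begin
        frac 1 (suc n) * g 0ℚ   ≡⟨ cong (frac 1 (suc n) *_) g0 ⟩
        frac 1 (suc n) * 0ℚ     ≡⟨ *-zeroʳ (frac 1 (suc n)) ⟩
        0ℚ                      ≡⟨ sym (frac-zero n) ⟩
        frac 0 (suc n)          ≡⟨ cong (λ s → frac s (suc n)) (sym F≡0) ⟩
        frac F (suc n)          ∎
        where
        open ≡-Reasoning
        F : ℕ
        F = c (deg G u) ℕ.* outDeg G u
        F≡0 : F ≡ 0
        F≡0 = trans (cong (c (deg G u) ℕ.*_) (ℕ.n≤0⇒n≡0 (subst (outDeg G u ℕ.≤_) d≡ (outDeg≤deg G u))))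
                    (ℕ.*-zeroʳ (c (deg G u)))
      summandAt-moment u (suc k) d≡ = begin
        frac 1 (suc n) * (frac 1 (suc k) * sumℚ (map (g ∘ Yval G u) (nbrs G u)))
          ≡⟨ cong (λ s → frac 1 (suc n) * (frac 1 (suc k) * s)) neighbour-sum ⟩
        frac 1 (suc n) * (frac 1 (suc k) * ℕtoℚ (suc k ℕ.* F))
          ≡⟨ cong (frac 1 (suc n) *_) (frac-cancel k F) ⟩
        frac 1 (suc n) * ℕtoℚ F
          ≡⟨ frac-ℕtoℚ F n ⟩
        frac F (suc n) ∎
        where
        open ≡-Reasoning
        d P F : ℕ
        d = deg G u
        P = outDeg G u
        F = c d ℕ.* P
        neighbour-sum : sumℚ (map (g ∘ Yval G u) (nbrs G u)) ≡ ℕtoℚ (suc k ℕ.* F)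
        neighbour-sum = begin
          sumℚ (map (g ∘ Yval G u) (nbrs G u))  ≡⟨ sumℚ-map-if {g = g} g0 (prec G u) (ℕtoℚ (2 ℕ.* d)) (nbrs G u) ⟩
          g (ℕtoℚ (2 ℕ.* d)) * ℕtoℚ P           ≡⟨ cong (_* ℕtoℚ P) (g2d d) ⟩
          ℕtoℚ (d ℕ.* c d) * ℕtoℚ P             ≡⟨ sym (ℕtoℚ-* (d ℕ.* c d) P) ⟩
          ℕtoℚ (d ℕ.* c d ℕ.* P)                ≡⟨ cong ℕtoℚ (ℕ.*-assoc d (c d) P) ⟩
          ℕtoℚ (d ℕ.* F)                        ≡⟨ cong (λ e → ℕtoℚ (e ℕ.* F)) d≡ ⟩
          ℕtoℚ (suc k ℕ.* F)                    ∎

      expect-moment : expect G g ≡ frac (∑[ u < suc n ] (c (deg G u) ℕ.* outDeg G u)) (suc n)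
      expect-moment = begin
        expect G g
          ≡⟨ expect-summands G g ⟩
        sumℚ (map (λ u → summandAt G g u (deg G u)) (allFin (suc n)))
          ≡⟨ cong sumℚ (List.map-cong (λ u → summandAt-moment u (deg G u) refl) (allFin (suc n))) ⟩
        sumℚ (map (λ u → frac (F u) (suc n)) (allFin (suc n)))
          ≡⟨ sumℚ-map-frac (allFin (suc n)) F n ⟩
        frac (sum (map F (allFin (suc n)))) (suc n)
          ≡⟨ cong (λ s → frac s (suc n)) (sum-map-allFin F) ⟩
        frac (∑[ u < suc n ] F u) (suc n) ∎
        where
        open ≡-Reasoning
        F : Fin (suc n) → ℕ
        F u = c (deg G u) ℕ.* outDeg G u

    EY≡avgDeg : EY G ≡ avgDeg G
    EY≡avgDeg = begin
      EY G
        ≡⟨ expect-moment (λ _ → 2) refl (λ d → cong ℕtoℚ (ℕ.*-comm 2 d)) ⟩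
      frac (∑[ u < suc n ] (2 ℕ.* outDeg G u)) (suc n)
        ≡⟨ cong (λ s → frac s (suc n)) (sym (*-distribˡ-sum 2 (outDeg G))) ⟩
      frac (2 ℕ.* ∑[ u < suc n ] outDeg G u) (suc n)
        ≡⟨ cong (λ s → frac (2 ℕ.* s) (suc n)) (∑-outDeg G) ⟩
      avgDeg G ∎
      where open ≡-Reasoning

    E[Y²]≡ : expect G (λ y → y * y) ≡ frac (4 ℕ.* ∑[ u < suc n ] (deg G u ℕ.* outDeg G u)) (suc n)
    E[Y²]≡ = begin
      expect G (λ y → y * y)
        ≡⟨ expect-moment (4 ℕ.*_) refl (λ d → trans (sym (ℕtoℚ-* (2 ℕ.* d) (2 ℕ.* d))) (cong ℕtoℚ (square d))) ⟩
      frac (∑[ u < suc n ] (4 ℕ.* deg G u ℕ.* outDeg G u)) (suc n)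
        ≡⟨ cong (λ s → frac s (suc n)) (trans (sum-cong-≗ (λ u → ℕ.*-assoc 4 (deg G u) (outDeg G u)))
                                              (sym (*-distribˡ-sum 4 (λ u → deg G u ℕ.* outDeg G u)))) ⟩
      frac (4 ℕ.* ∑[ u < suc n ] (deg G u ℕ.* outDeg G u)) (suc n) ∎
      where
      open ≡-Reasoning
      square : ∀ d → 2 ℕ.* d ℕ.* (2 ℕ.* d) ≡ d ℕ.* (4 ℕ.* d)
      square = ℕ-Solver.solve-∀

    VarY≡ : VarY G ≡ expect G (λ y → y * y) - EY G * EY G
    VarY≡ = begin
      VarY G
        ≡⟨ expect-linear G (- (μ + μ)) (λ y → expand y μ) ⟩
      expect G (λ y → y * y + μ * μ * 1ℚ) + - (μ + μ) * μ
        ≡⟨ cong (_+ - (μ + μ) * μ) (expect-linear G (μ * μ) (λ _ → refl)) ⟩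
      (expect G (λ y → y * y) + μ * μ * expect G (λ _ → 1ℚ)) + - (μ + μ) * μ
        ≡⟨ cong (λ e → (expect G (λ y → y * y) + μ * μ * e) + - (μ + μ) * μ) expect-const-1 ⟩
      (expect G (λ y → y * y) + μ * μ * 1ℚ) + - (μ + μ) * μ
        ≡⟨ collect (expect G (λ y → y * y)) μ ⟩
      expect G (λ y → y * y) - μ * μ ∎
      where
      open ≡-Reasoning
      μ : ℚ
      μ = EY G
      expand : ∀ y m → (y - m) * (y - m) ≡ (y * y + m * m * 1ℚ) + - (m + m) * y
      expand = solve 2 (λ y m → (y :- m) :* (y :- m) := (y :* y :+ m :* m :* con 1ℚ) :+ (:- (m :+ m)) :* y) refl
      collect : ∀ e m → (e + m * m * 1ℚ) + - (m + m) * m ≡ e - m * m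
      collect = solve 2 (λ e m → (e :+ m :* m :* con 1ℚ) :+ (:- (m :+ m)) :* m := e :- m :* m) refl

    VarY≤E[Y²] : VarY G ≤ expect G (λ y → y * y)
    VarY≤E[Y²] = begin
      VarY G                        ≡⟨ VarY≡ ⟩
      E2 - EY G * EY G              ≤⟨ +-monoʳ-≤ E2 (neg-antimono-≤ μ²≥0) ⟩
      E2 - 0ℚ                       ≡⟨ +-identityʳ E2 ⟩
      E2                            ∎
      where
      open ≤-Reasoning
      E2 : ℚ
      E2 = expect G (λ y → y * y)
      μ²≥0 : 0ℚ ≤ EY G * EY G
      μ²≥0 = subst (λ μ → 0ℚ ≤ μ * μ) (sym EY≡avgDeg) (0≤frac*frac (2 ℕ.* numEdges G) n (2 ℕ.* numEdges G) n)

    E[Y²]≤8dα : ∀ {α} → ForestCover G α → expect G (λ y → y * y) ≤ ℕtoℚ 8 * avgDeg G * ℕtoℚ α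
    E[Y²]≤8dα {α} cover = begin
      expect G (λ y → y * y)
        ≡⟨ E[Y²]≡ ⟩
      frac (4 ℕ.* ∑[ u < suc n ] (deg G u ℕ.* outDeg G u)) (suc n)
        ≤⟨ frac-mono-≤ n (ℕ.*-monoʳ-≤ 4 (∑-deg*outDeg≤ G cover)) ⟩
      frac (4 ℕ.* (α ℕ.* (2 ℕ.* ∑[ u < suc n ] deg G u))) (suc n)
        ≡⟨ cong (λ s → frac (4 ℕ.* (α ℕ.* (2 ℕ.* s))) (suc n)) (∑-deg G) ⟩
      frac (4 ℕ.* (α ℕ.* (2 ℕ.* (2 ℕ.* numEdges G)))) (suc n)
        ≡⟨ cong (λ s → frac s (suc n)) (regroup α (numEdges G)) ⟩
      frac (8 ℕ.* (2 ℕ.* numEdges G) ℕ.* α) (suc n)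
        ≡⟨ sym (ℕtoℚ*frac*ℕtoℚ 8 (2 ℕ.* numEdges G) α n) ⟩
      ℕtoℚ 8 * avgDeg G * ℕtoℚ α ∎
      where
      open ≤-Reasoning
      regroup : ∀ a m → 4 ℕ.* (a ℕ.* (2 ℕ.* (2 ℕ.* m))) ≡ 8 ℕ.* (2 ℕ.* m) ℕ.* a
      regroup = ℕ-Solver.solve-∀

open import Data.Nat using (ℕ; NonZero; suc)
open import Data.Product using (_×_; _,_)
open import Data.Rational using (_≤_; _*_)
open import Data.Rational.Properties using (≤-trans)
open import Relation.Binary.PropositionalEquality using (_≡_)
open Moments using (EY≡avgDeg; VarY≤E[Y²]; E[Y²]≤8dα)

claim2p1 : ∀ (n : ℕ) → .{{_ : NonZero n}} → (G : Graph n) → (α : ℕ) →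
           IsArboricity G α →
           (EY G ≡ avgDeg G) × (VarY G ≤ ℕtoℚ 8 * avgDeg G * ℕtoℚ α)
claim2p1 (suc n) G α (cover , _) = EY≡avgDeg G , ≤-trans (VarY≤E[Y²] G) (E[Y²]≤8dα G cover)
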